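{- For all positive integers $\gamma$ and $n$ with $\gamma\ge2$ and $n\le\gamma+1$, $$\#\mathbf{CAs}^{(\gamma)}(n)=\mathrm{cat}(n-1)-\delta_{n,\gamma+1},$$ where $\mathrm{cat}(k)=\frac{1}{k+1}\binom{2k}{k}$ is the $k$-th Catalan number and $\delta$ is the Kronecker delta.
   Context: A binary tree is either the leaf or an ordered pair of binary trees; arity = number of leaves, degree = number of internal nodes. $\mathbf{Mag}$ is the nonsymmetric set-theoretic operad of binary trees ($\mathbf{Mag}(n)$ = trees of arity $n$), with $\mathfrak{t}\circ_i\mathfrak{s}$ grafting the root of $\mathfrak{s}$ onto the $i$-th leaf of $\mathfrak{t}$. Combs: $\mathrm{LComb}_1=\mathrm{RComb}_1=(\text{leaf},\text{leaf})$, $\mathrm{LComb}_d=(\mathrm{LComb}_{d-1},\text{leaf})$, $\mathrm{RComb}_d=(\text{leaf},\mathrm{RComb}_{d-1})$. For $\gamma\ge1$, $\equiv_\gamma$ is the smallest operad congruence on $\mathbf{Mag}$ (arity-preserving equivalence relation compatible with all partial compositions) with $\mathrm{LComb}_\gamma\equiv_\gamma\mathrm{RComb}_\gamma$, and $\mathbf{CAs}^{(\gamma)}:=\mathbf{Mag}/_{\equiv_\gamma}$ (the $\gamma$-comb associative operad). -}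

module Defs where

open import Data.Nat using (ℕ; zero; suc; _+_; _∸_; _*_; _<ᵇ_; _≡ᵇ_; _<_)
open import Data.Nat.DivMod using (_/_)
open import Data.Nat.Combinatorics using (_C_)
open import Data.Bool using (if_then_else_)
open import Data.Fin using (Fin)
open import Data.Product using (Σ; _×_)
open import Relation.Binary.PropositionalEquality using (_≡_)
open import Relation.Nullary using (¬_)

data Tree : Set where
  leaf : Tree
  node : Tree → Tree → Tree

arity : Tree → ℕ
arity leaf = 1
arity (node l r) = arity l + arity r

-- Partial composition in Mag: graft t i s grafts the root of s onto the
-- i-th leaf of t, leaves numbered from 0 (left to right); i.e. t ∘_{i+1} s.
-- (Only used for i < arity t.)
graft : Tree → ℕ → Tree → Tree
graft leaf zero s = s
graft leaf (suc i) s = leaf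
graft (node l r) i s =
  if i <ᵇ arity l then node (graft l i s) r else node l (graft r (i ∸ arity l) s)

lcomb : ℕ → Tree
lcomb zero = leaf
lcomb (suc d) = node (lcomb d) leaf

rcomb : ℕ → Tree
rcomb zero = leaf
rcomb (suc d) = node leaf (rcomb d)

-- ≡_γ : the smallest operad congruence on Mag with LComb_γ ≡ RComb_γ
-- (equivalence relation closed under partial compositions, generated by the comb pair).
data CombCong (γ : ℕ) : Tree → Tree → Set where
  gen   : CombCong γ (lcomb γ) (rcomb γ)
  refl  : ∀ {t} → CombCong γ t t
  sym   : ∀ {t u} → CombCong γ t u → CombCong γ u t
  trans : ∀ {t u v} → CombCong γ t u → CombCong γ u v → CombCong γ t v
  comp  : ∀ {t t' s s'} (i : ℕ) → i < arity t →
          CombCong γ t t' → CombCong γ s s' →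
          CombCong γ (graft t i s) (graft t' i s')

Mag : ℕ → Set
Mag n = Σ Tree (λ t → arity t ≡ n)

-- #CAs^(γ)(n) = k : the set Mag(n)/≡_γ has exactly k elements, i.e. there is a
-- bijection Fin k ≅ Mag(n)/≡_γ, given by a map Fin k → Mag(n) that is injective
-- modulo ≡_γ and surjective onto the classes.
CAsCard : ℕ → ℕ → ℕ → Set
CAsCard γ n k =
  Σ (Fin k → Mag n) λ f →
    (∀ i j → CombCong γ (Σ.proj₁ (f i)) (Σ.proj₁ (f j)) → i ≡ j) ×
    (∀ (t : Mag n) → Σ (Fin k) λ i → CombCong γ (Σ.proj₁ t) (Σ.proj₁ (f i)))

cat : ℕ → ℕ
cat k = ((2 * k) C k) / suc k

δ : ℕ → ℕ → ℕ
δ m n = if m ≡ᵇ n then 1 else 0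

-- Below arity γ + 2 the congruence ≡_γ is rigid: a derivation of t ≡_γ u between trees with at most
-- γ internal nodes only ever relates equal trees or two combs of degree γ, since grafting anything
-- but a leaf onto a comb of degree γ (or grafting a comb into anything but a leaf) exceeds degree γ.
-- So for n ≤ γ the classes of Mag(n) are single trees, and for n = γ + 1 exactly LComb_γ and
-- RComb_γ, distinct when γ ≥ 2, are merged. Trees are counted through forests: the number of
-- forests of m trees with k internal nodes obeys the ballot recurrence, whose solution
-- C(m + 2k - 1, k) - C(m + 2k - 1, k - 1) is cat(k) at m = 1.
module Submission where

open import Defs
open import Data.Nat using (ℕ; zero; suc; _+_; _*_; _∸_; _≤_; _<_; _<ᵇ_; _≡ᵇ_; s≤s; s≤s⁻¹; _≟_)
open import Data.Nat.Properties
open import Data.Nat.Combinatorics using (_C_; nCk≡nC[n∸k]; nC1≡n)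
  renaming (nCk+nC[k+1]≡[n+1]C[k+1] to pascal)
open import Data.Nat.DivMod using (_/_; m*n/n≡m)
open import Algebra.Properties.CommutativeSemigroup +-commutativeSemigroup
  using (interchange; xy∙z≈xz∙y)
open import Data.Bool using (true; false; T)
open import Data.Fin using (Fin; splitAt; join; punchIn; punchOut)
import Data.Fin as Fin
open import Data.Fin.Properties
  using (splitAt-join; join-splitAt; punchIn-injective; punchInᵢ≢i; punchIn-punchOut)
open import Data.Vec using (Vec; []; _∷_; replicate; head)
open import Data.Product using (Σ; _×_; _,_; proj₁; proj₂)
open import Data.Sum using (_⊎_; inj₁; inj₂)
import Data.Sum as Sum
open import Data.Sum.Properties using (inj₁-injective; inj₂-injective)
open import Data.Sum.Relation.Unary.All using (All; inj₁; inj₂)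
open import Data.Empty using (⊥-elim)
open import Function using (_∘_)
open import Function.Definitions using (Injective)
open import Relation.Nullary using (¬_; yes; no)
open import Relation.Nullary.Reflects using (ofʸ; ofⁿ)
open import Relation.Nullary.Decidable using (map′; _×-dec_)
open import Relation.Binary.Definitions using (DecidableEquality)
open import Relation.Binary.PropositionalEquality as ≡
  using (_≡_; _≢_; refl; cong; cong₂; subst; subst₂)
open ≡.≡-Reasoning

deg : Tree → ℕ
deg leaf = 0
deg (node l r) = suc (deg l + deg r)

arity≡suc-deg : ∀ t → arity t ≡ suc (deg t)
arity≡suc-deg leaf = refl
arity≡suc-deg (node l r)
  rewrite arity≡suc-deg l | arity≡suc-deg r = cong suc (+-suc (deg l) (deg r))

arity≡suc⇒deg≡ : ∀ {t d} → arity t ≡ suc d → deg t ≡ d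
arity≡suc⇒deg≡ {t} eq = suc-injective (≡.trans (≡.sym (arity≡suc-deg t)) eq)

arity≤⇒deg≤ : ∀ {t d} → arity t ≤ suc d → deg t ≤ d
arity≤⇒deg≤ {t} le = s≤s⁻¹ (subst (_≤ _) (arity≡suc-deg t) le)

deg≡⇒arity≡ : ∀ {t u} → deg t ≡ deg u → arity t ≡ arity u
deg≡⇒arity≡ {t} {u} eq =
  ≡.trans (arity≡suc-deg t) (≡.trans (cong suc eq) (≡.sym (arity≡suc-deg u)))

deg≡0⇒leaf : ∀ {t} → deg t ≡ 0 → t ≡ leaf
deg≡0⇒leaf {leaf} _ = refl

node-injective : ∀ {l r l′ r′} → node l r ≡ node l′ r′ → l ≡ l′ × r ≡ r′
node-injective refl = refl , refl

_≟ᵗ_ : DecidableEquality Tree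
leaf ≟ᵗ leaf = yes refl
leaf ≟ᵗ node _ _ = no λ ()
node _ _ ≟ᵗ leaf = no λ ()
node l r ≟ᵗ node l′ r′ =
  map′ (λ (p , q) → cong₂ node p q) node-injective (l ≟ᵗ l′ ×-dec r ≟ᵗ r′)

deg-lcomb : ∀ d → deg (lcomb d) ≡ d
deg-lcomb zero = refl
deg-lcomb (suc d) = cong suc (≡.trans (+-identityʳ _) (deg-lcomb d))

deg-rcomb : ∀ d → deg (rcomb d) ≡ d
deg-rcomb zero = refl
deg-rcomb (suc d) = cong suc (deg-rcomb d)

lcomb≢rcomb : ∀ {d} → 2 ≤ d → lcomb d ≢ rcomb d
lcomb≢rcomb {suc zero} (s≤s ())
lcomb≢rcomb {suc (suc d)} _ ()

deg-graft : ∀ t i s → i < arity t → deg (graft t i s) ≡ deg t + deg s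
deg-graft leaf zero s _ = refl
deg-graft leaf (suc i) s (s≤s ())
deg-graft (node l r) i s i<lr with i <ᵇ arity l | <ᵇ-reflects-< i (arity l)
... | true | ofʸ i<l = cong suc (begin
  deg (graft l i s) + deg r  ≡⟨ cong (_+ deg r) (deg-graft l i s i<l) ⟩
  deg l + deg s + deg r      ≡⟨ xy∙z≈xz∙y (deg l) (deg s) (deg r) ⟩
  deg l + deg r + deg s      ∎)
... | false | ofⁿ i≮l = cong suc (begin
  deg l + deg (graft r (i ∸ arity l) s)
    ≡⟨ cong (deg l +_) (deg-graft r (i ∸ arity l) s i-l<r) ⟩
  deg l + (deg r + deg s)
    ≡⟨ +-assoc (deg l) (deg r) (deg s) ⟨
  deg l + deg r + deg s
    ∎)
  where
  i-l<r : i ∸ arity l < arity r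
  i-l<r = subst (i ∸ arity l <_) (m+n∸m≡n (arity l) (arity r)) (∸-monoˡ-< i<lr (≮⇒≥ i≮l))

graft-leaf : ∀ t i → graft t i leaf ≡ t
graft-leaf leaf zero = refl
graft-leaf leaf (suc i) = refl
graft-leaf (node l r) i with i <ᵇ arity l
... | true = cong (λ l′ → node l′ r) (graft-leaf l i)
... | false = cong (node l) (graft-leaf r (i ∸ arity l))

graft-deg-≤ˡ : ∀ t i s → i < arity t → deg (graft t i s) ≤ deg t → s ≡ leaf
graft-deg-≤ˡ t i s i<t le = deg≡0⇒leaf (n≤0⇒n≡0 (+-cancelˡ-≤ (deg t) (deg s) 0
  (subst₂ _≤_ (deg-graft t i s i<t) (≡.sym (+-identityʳ (deg t))) le)))

graft-deg-≤ʳ : ∀ t i s → i < arity t → deg (graft t i s) ≤ deg s → t ≡ leaf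
graft-deg-≤ʳ t i s i<t le = deg≡0⇒leaf (n≤0⇒n≡0 (+-cancelʳ-≤ (deg s) (deg t) 0
  (subst (_≤ deg s) (deg-graft t i s i<t) le)))

CombCong-deg : ∀ {γ t u} → CombCong γ t u → deg t ≡ deg u
CombCong-deg {γ} gen = ≡.trans (deg-lcomb γ) (≡.sym (deg-rcomb γ))
CombCong-deg refl = refl
CombCong-deg (sym c) = ≡.sym (CombCong-deg c)
CombCong-deg (trans c c′) = ≡.trans (CombCong-deg c) (CombCong-deg c′)
CombCong-deg (comp {t} {t′} {s} {s′} i i<t c c′) = begin
  deg (graft t i s)
    ≡⟨ deg-graft t i s i<t ⟩
  deg t + deg s
    ≡⟨ cong₂ _+_ (CombCong-deg c) (CombCong-deg c′) ⟩
  deg t′ + deg s′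
    ≡⟨ deg-graft t′ i s′ (subst (i <_) (deg≡⇒arity≡ (CombCong-deg c)) i<t) ⟨
  deg (graft t′ i s′)
    ∎

IsComb : ℕ → Tree → Set
IsComb γ t = t ≡ lcomb γ ⊎ t ≡ rcomb γ

EqualOrCombs : ℕ → Tree → Tree → Set
EqualOrCombs γ t u = t ≡ u ⊎ (IsComb γ t × IsComb γ u)

IsComb-deg : ∀ {γ t} → IsComb γ t → deg t ≡ γ
IsComb-deg {γ} (inj₁ refl) = deg-lcomb γ
IsComb-deg {γ} (inj₂ refl) = deg-rcomb γ

IsComb-arity : ∀ {γ t} → IsComb γ t → arity t ≡ suc γ
IsComb-arity {t = t} c = ≡.trans (arity≡suc-deg t) (cong suc (IsComb-deg c))

EqualOrCombs-sym : ∀ {γ t u} → EqualOrCombs γ t u → EqualOrCombs γ u t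
EqualOrCombs-sym (inj₁ eq) = inj₁ (≡.sym eq)
EqualOrCombs-sym (inj₂ (ct , cu)) = inj₂ (cu , ct)

EqualOrCombs-trans : ∀ {γ t u v} →
  EqualOrCombs γ t u → EqualOrCombs γ u v → EqualOrCombs γ t v
EqualOrCombs-trans (inj₁ refl) q = q
EqualOrCombs-trans (inj₂ c) (inj₁ refl) = inj₂ c
EqualOrCombs-trans (inj₂ (ct , _)) (inj₂ (_ , cv)) = inj₂ (ct , cv)

EqualOrCombs-graft : ∀ {γ t t′ s s′} i → i < arity t →
  deg (graft t i s) ≤ γ → deg s ≡ deg s′ →
  EqualOrCombs γ t t′ → EqualOrCombs γ s s′ →
  EqualOrCombs γ (graft t i s) (graft t′ i s′)
EqualOrCombs-graft i i<t small ds (inj₁ refl) (inj₁ refl) = inj₁ refl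
EqualOrCombs-graft {t = t} {t′} {s} i i<t small ds (inj₂ (ct , ct′)) _
  with refl ← graft-deg-≤ˡ t i s i<t (subst (_ ≤_) (≡.sym (IsComb-deg ct)) small)
  with refl ← deg≡0⇒leaf (≡.sym ds)
  rewrite graft-leaf t i | graft-leaf t′ i = inj₂ (ct , ct′)
EqualOrCombs-graft {t = t} {s = s} i i<t small ds (inj₁ refl) (inj₂ (cs , cs′))
  with refl ← graft-deg-≤ʳ t i s i<t (subst (_ ≤_) (≡.sym (IsComb-deg cs)) small)
  with refl ← n<1⇒n≡0 i<t = inj₂ (cs , cs′)

CombCong-rigid : ∀ {γ t u} → CombCong γ t u → deg t ≤ γ → EqualOrCombs γ t u
CombCong-rigid gen _ = inj₂ (inj₁ refl , inj₂ refl)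
CombCong-rigid refl _ = inj₁ refl
CombCong-rigid (sym c) small =
  EqualOrCombs-sym (CombCong-rigid c (subst (_≤ _) (CombCong-deg (sym c)) small))
CombCong-rigid (trans c c′) small =
  EqualOrCombs-trans (CombCong-rigid c small)
                     (CombCong-rigid c′ (subst (_≤ _) (CombCong-deg c) small))
CombCong-rigid (comp {t} {s = s} i i<t c c′) small =
  EqualOrCombs-graft i i<t small (CombCong-deg c′)
    (CombCong-rigid c (m+n≤o⇒m≤o (deg t) split))
    (CombCong-rigid c′ (m+n≤o⇒n≤o (deg t) split))
  where
  split : deg t + deg s ≤ _
  split = subst (_≤ _) (deg-graft t i s i<t) small

record Enumeration {A : Set} (P : A → Set) (N : ℕ) : Set where
  field
    elem : Fin N → A
    valid : ∀ i → P (elem i)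
    injective : Injective _≡_ _≡_ elem
    surjective : ∀ x → P x → Σ (Fin N) λ i → elem i ≡ x

module _ {A : Set} {P : A → Set} where

  enum-empty : (∀ x → ¬ P x) → Enumeration P 0
  enum-empty ¬P = record
    { elem = λ ()
    ; valid = λ ()
    ; injective = λ { {()} }
    ; surjective = λ x px → ⊥-elim (¬P x px)
    }

  enum-singleton : ∀ {x} → P x → (∀ y → P y → y ≡ x) → Enumeration P 1
  enum-singleton {x} px unique = record
    { elem = λ _ → x
    ; valid = λ _ → px
    ; injective = λ { {Fin.zero} {Fin.zero} _ → refl }
    ; surjective = λ y py → Fin.zero , ≡.sym (unique y py)
    }

  enum-map : ∀ {B : Set} {Q : B → Set} {N} (f : A → B) → Injective _≡_ _≡_ f →
    (∀ x → P x → Q (f x)) → (∀ y → Q y → Σ A λ x → P x × f x ≡ y) →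
    Enumeration P N → Enumeration Q N
  enum-map f f-injective f-valid f-onto E = record
    { elem = f ∘ elem
    ; valid = λ i → f-valid (elem i) (valid i)
    ; injective = injective ∘ f-injective
    ; surjective = λ y qy →
        let (x , px , fx≡y) = f-onto y qy
            (i , ei) = surjective x px
        in i , ≡.trans (cong f ei) fx≡y
    }
    where open Enumeration E

  enum-remove : ∀ {N x} → Enumeration P N → P x →
    Enumeration (λ y → P y × y ≢ x) (N ∸ 1)
  enum-remove {zero} {x} E px with () ← proj₁ (Enumeration.surjective E x px)
  enum-remove {suc N} {x} E px = record
    { elem = elem ∘ punchIn j
    ; valid = λ i →
        valid (punchIn j i) , λ eq → punchInᵢ≢i j i (injective (≡.trans eq (≡.sym ej)))
    ; injective = punchIn-injective j _ _ ∘ injective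
    ; surjective = λ y (py , y≢x) →
        let (i , ei) = surjective y py
            j≢i : j ≢ i
            j≢i j≡i = y≢x (≡.trans (≡.sym ei) (≡.trans (cong elem (≡.sym j≡i)) ej))
        in punchOut j≢i , ≡.trans (cong elem (punchIn-punchOut j≢i)) ei
    }
    where
    open Enumeration E
    j = proj₁ (surjective x px)
    ej = proj₂ (surjective x px)

enum-⊎ : ∀ {A B : Set} {P : A → Set} {Q : B → Set} {a b} →
  Enumeration P a → Enumeration Q b → Enumeration (All P Q) (a + b)
enum-⊎ {P = P} {Q} {a} {b} E F = record
  { elem = elem⊎ ∘ splitAt a
  ; valid = valid⊎ ∘ splitAt a
  ; injective = λ {i} {j} eq → begin
      i                       ≡⟨ join-splitAt a b i ⟨
      join a b (splitAt a i)  ≡⟨ cong (join a b) (injective⊎ {splitAt a i} {splitAt a j} eq) ⟩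
      join a b (splitAt a j)  ≡⟨ join-splitAt a b j ⟩
      j                       ∎
  ; surjective = λ x px → let (u , eu) = surjective⊎ x px in
      join a b u , ≡.trans (cong elem⊎ (splitAt-join a b u)) eu
  }
  where
  module E = Enumeration E
  module F = Enumeration F
  elem⊎ = Sum.map E.elem F.elem
  valid⊎ : ∀ u → All P Q (elem⊎ u)
  valid⊎ (inj₁ i) = inj₁ (E.valid i)
  valid⊎ (inj₂ i) = inj₂ (F.valid i)
  injective⊎ : Injective _≡_ _≡_ elem⊎
  injective⊎ {inj₁ _} {inj₁ _} eq = cong inj₁ (E.injective (inj₁-injective eq))
  injective⊎ {inj₂ _} {inj₂ _} eq = cong inj₂ (F.injective (inj₂-injective eq))
  surjective⊎ : ∀ x → All P Q x → Σ _ λ u → elem⊎ u ≡ x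
  surjective⊎ (inj₁ x) (inj₁ px) = let (i , ei) = E.surjective x px in inj₁ i , cong inj₁ ei
  surjective⊎ (inj₂ x) (inj₂ px) = let (i , ei) = F.surjective x px in inj₂ i , cong inj₂ ei

degs : ∀ {m} → Vec Tree m → ℕ
degs [] = 0
degs (t ∷ ts) = deg t + degs ts

-- Forests of m trees with k internal nodes: the first tree is either a leaf, which can be
-- dropped, or a node, which can be split into its two subtrees.
forestCount : ℕ → ℕ → ℕ
forestCount m zero = 1
forestCount zero (suc k) = 0
forestCount (suc m) (suc k) = forestCount m (suc k) + forestCount (suc (suc m)) k

degs-replicate-leaf : ∀ m → degs (replicate m leaf) ≡ 0
degs-replicate-leaf zero = refl
degs-replicate-leaf (suc m) = degs-replicate-leaf m

degs≡0⇒replicate-leaf : ∀ {m} (ts : Vec Tree m) → degs ts ≡ 0 → ts ≡ replicate m leaf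
degs≡0⇒replicate-leaf [] _ = refl
degs≡0⇒replicate-leaf (t ∷ ts) eq =
  cong₂ _∷_ (deg≡0⇒leaf (m+n≡0⇒m≡0 (deg t) eq))
            (degs≡0⇒replicate-leaf ts (m+n≡0⇒n≡0 (deg t) eq))

leafOrJoin : ∀ {m} → Vec Tree m ⊎ Vec Tree (suc (suc m)) → Vec Tree (suc m)
leafOrJoin (inj₁ ts) = leaf ∷ ts
leafOrJoin (inj₂ (l ∷ r ∷ ts)) = node l r ∷ ts

leafOrJoin-injective : ∀ {m} → Injective _≡_ _≡_ (leafOrJoin {m})
leafOrJoin-injective {x = inj₁ _} {inj₁ _} refl = refl
leafOrJoin-injective {x = inj₁ _} {inj₂ (_ ∷ _ ∷ _)} ()
leafOrJoin-injective {x = inj₂ (_ ∷ _ ∷ _)} {inj₁ _} ()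
leafOrJoin-injective {x = inj₂ (_ ∷ _ ∷ _)} {inj₂ (_ ∷ _ ∷ _)} refl = refl

leafOrJoin-degs : ∀ {m k} x → All (λ ts → degs ts ≡ suc k) (λ ts → degs ts ≡ k) x →
  degs (leafOrJoin {m} x) ≡ suc k
leafOrJoin-degs (inj₁ _) (inj₁ eq) = eq
leafOrJoin-degs (inj₂ (l ∷ r ∷ ts)) (inj₂ eq) =
  cong suc (≡.trans (+-assoc (deg l) (deg r) (degs ts)) eq)

leafOrJoin-onto : ∀ {m k} (ts : Vec Tree (suc m)) → degs ts ≡ suc k →
  Σ _ λ x → All (λ ts → degs ts ≡ suc k) (λ ts → degs ts ≡ k) x × leafOrJoin x ≡ ts
leafOrJoin-onto (leaf ∷ ts) eq = inj₁ ts , inj₁ eq , refl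
leafOrJoin-onto (node l r ∷ ts) eq =
  inj₂ (l ∷ r ∷ ts) ,
  inj₂ (≡.trans (≡.sym (+-assoc (deg l) (deg r) (degs ts))) (suc-injective eq)) ,
  refl

forests-enumeration : ∀ m k →
  Enumeration (λ (ts : Vec Tree m) → degs ts ≡ k) (forestCount m k)
forests-enumeration m zero =
  enum-singleton (degs-replicate-leaf m) degs≡0⇒replicate-leaf
forests-enumeration zero (suc k) = enum-empty λ { [] () }
forests-enumeration (suc m) (suc k) =
  enum-map leafOrJoin leafOrJoin-injective leafOrJoin-degs leafOrJoin-onto
    (enum-⊎ (forests-enumeration m (suc k)) (forests-enumeration (suc (suc m)) k))

trees-enumeration : ∀ k → Enumeration (λ t → arity t ≡ suc k) (forestCount 1 k)
trees-enumeration k = enum-map head head-injective arity-head onto (forests-enumeration 1 k)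
  where
  head-injective : Injective _≡_ _≡_ (head {n = 0})
  head-injective {_ ∷ []} {_ ∷ []} refl = refl
  arity-head : ∀ ts → degs ts ≡ k → arity (head ts) ≡ suc k
  arity-head (t ∷ []) eq =
    ≡.trans (arity≡suc-deg t) (cong suc (≡.trans (≡.sym (+-identityʳ (deg t))) eq))
  onto : ∀ t → arity t ≡ suc k → Σ _ λ ts → degs ts ≡ k × head ts ≡ t
  onto t eq = t ∷ [] , ≡.trans (+-identityʳ (deg t)) (arity≡suc⇒deg≡ eq) , refl

C-absorption : ∀ n k → suc k * (suc n C suc k) ≡ suc n * (n C k)
C-absorption zero zero = refl
C-absorption zero (suc k) = *-zeroʳ (suc (suc k))
C-absorption (suc n) zero = begin
  1 * (suc (suc n) C 1)  ≡⟨ *-identityˡ _ ⟩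
  suc (suc n) C 1        ≡⟨ nC1≡n (suc (suc n)) ⟩
  suc (suc n)            ≡⟨ *-identityʳ (suc (suc n)) ⟨
  suc (suc n) * 1        ∎
C-absorption (suc n) (suc k) = begin
  suc (suc k) * (suc (suc n) C suc (suc k))
    ≡⟨ cong (suc (suc k) *_) (pascal (suc n) (suc k)) ⟨
  suc (suc k) * (x + y)
    ≡⟨ *-distribˡ-+ (suc (suc k)) x y ⟩
  x + suc k * x + suc (suc k) * y
    ≡⟨ cong₂ (λ u v → x + u + v) (C-absorption n k) (C-absorption n (suc k)) ⟩
  x + suc n * (n C k) + suc n * (n C suc k)
    ≡⟨ +-assoc x _ _ ⟩
  x + (suc n * (n C k) + suc n * (n C suc k))
    ≡⟨ cong (x +_) (*-distribˡ-+ (suc n) (n C k) (n C suc k)) ⟨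
  x + suc n * (n C k + n C suc k)
    ≡⟨ cong (λ u → x + suc n * u) (pascal n k) ⟩
  suc (suc n) * x
    ∎
  where
  x = suc n C suc k
  y = suc n C suc (suc k)

C-ratio : ∀ k m → suc k * ((suc k + m) C suc k) ≡ suc m * ((suc k + m) C k)
C-ratio k m = +-cancelˡ-≡ (suc k * a) _ _ (begin
  suc k * a + suc k * b    ≡⟨ *-distribˡ-+ (suc k) a b ⟨
  suc k * (a + b)          ≡⟨ cong (suc k *_) (pascal n k) ⟩
  suc k * (suc n C suc k)  ≡⟨ C-absorption n k ⟩
  suc n * a                ≡⟨ cong (λ u → suc u * a) (+-suc k m) ⟨
  (suc k + suc m) * a      ≡⟨ *-distribʳ-+ a (suc k) (suc m) ⟩
  suc k * a + suc m * a    ∎)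
  where
  n = suc k + m
  a = n C k
  b = n C suc k

forestCount-one : ∀ m → forestCount m 1 ≡ m
forestCount-one zero = refl
forestCount-one (suc m) = ≡.trans (cong (_+ 1) (forestCount-one m)) (+-comm m 1)

ballot-index-shift : ∀ m k → suc (suc (m + k + k)) ≡ m + suc k + suc k
ballot-index-shift m k = ≡.sym (begin
  m + suc k + suc k      ≡⟨ cong (_+ suc k) (+-suc m k) ⟩
  suc (m + k + suc k)    ≡⟨ cong suc (+-suc (m + k) k) ⟩
  suc (suc (m + k + k))  ∎)

-- forestCount (m + 1) (k + 1) = C(n, k + 1) - C(n, k) with n = m + 2k + 2, without subtraction.
forestCount-ballot : ∀ m k → let n = m + suc k + suc k in
  forestCount (suc m) (suc k) + n C k ≡ n C suc k
forestCount-ballot m zero = begin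
  forestCount (suc m) 1 + 1  ≡⟨ cong (_+ 1) (forestCount-one (suc m)) ⟩
  suc m + 1                  ≡⟨ +-comm (m + 1) 1 ⟨
  m + 1 + 1                  ≡⟨ nC1≡n (m + 1 + 1) ⟨
  (m + 1 + 1) C 1            ∎
forestCount-ballot zero (suc k) = begin
  f + suc n C suc k            ≡⟨ cong (f +_) (pascal n k) ⟨
  f + (n C k + n C suc k)      ≡⟨ +-assoc f _ _ ⟨
  f + n C k + n C suc k        ≡⟨ cong (_+ n C suc k) previous ⟩
  n C suc k + n C suc k        ≡⟨ cong (n C suc k +_) symmetric ⟩
  n C suc k + n C suc (suc k)  ≡⟨ pascal n (suc k) ⟩
  suc n C suc (suc k)          ∎
  where
  n = suc k + suc (suc k)
  f = forestCount 2 (suc k)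
  previous : f + n C k ≡ n C suc k
  previous = subst (λ n′ → f + n′ C k ≡ n′ C suc k)
    (suc-injective (ballot-index-shift 0 (suc k))) (forestCount-ballot 1 k)
  symmetric : n C suc k ≡ n C suc (suc k)
  symmetric = ≡.trans (nCk≡nC[n∸k] (m≤m+n (suc k) (suc (suc k))))
                      (cong (n C_) (m+n∸m≡n (suc k) (suc (suc k))))
forestCount-ballot (suc m) (suc k) = begin
  (f + f′) + suc n C suc k        ≡⟨ cong ((f + f′) +_) (pascal n k) ⟨
  (f + f′) + (n C k + n C suc k)  ≡⟨ cong ((f + f′) +_) (+-comm (n C k) _) ⟩
  (f + f′) + (n C suc k + n C k)  ≡⟨ interchange f f′ _ _ ⟩
  (f + n C suc k) + (f′ + n C k)  ≡⟨ cong₂ _+_ (forestCount-ballot m (suc k)) previous ⟩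
  n C suc (suc k) + n C suc k     ≡⟨ +-comm _ (n C suc k) ⟩
  n C suc k + n C suc (suc k)     ≡⟨ pascal n (suc k) ⟩
  suc n C suc (suc k)             ∎
  where
  n = m + suc (suc k) + suc (suc k)
  f = forestCount (suc m) (suc (suc k))
  f′ = forestCount (suc (suc (suc m))) (suc k)
  previous : f′ + n C k ≡ n C suc k
  previous = subst (λ n′ → f′ + n′ C k ≡ n′ C suc k)
    (ballot-index-shift m (suc k)) (forestCount-ballot (suc (suc m)) k)

cat≡forestCount : ∀ k → cat k ≡ forestCount 1 k
cat≡forestCount zero = refl
cat≡forestCount (suc k) = begin
  ((2 * suc k) C suc k) / suc (suc k)  ≡⟨ cong (λ n′ → (n′ C suc k) / suc (suc k)) 2[k+1]≡n ⟩
  (n C suc k) / suc (suc k)            ≡⟨ cong (_/ suc (suc k)) f*[k+2]≡b ⟨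
  (f * suc (suc k)) / suc (suc k)      ≡⟨ m*n/n≡m f (suc (suc k)) ⟩
  f                                    ∎
  where
  n = suc k + suc k
  f = forestCount 1 (suc k)
  a = n C k
  b = n C suc k
  2[k+1]≡n : 2 * suc k ≡ n
  2[k+1]≡n = cong (suc k +_) (+-identityʳ (suc k))
  f+a≡b : f + a ≡ b
  f+a≡b = forestCount-ballot 0 k
  [k+1]f≡a : suc k * f ≡ a
  [k+1]f≡a = +-cancelʳ-≡ (suc k * a) _ _ (begin
    suc k * f + suc k * a  ≡⟨ *-distribˡ-+ (suc k) f a ⟨
    suc k * (f + a)        ≡⟨ cong (suc k *_) f+a≡b ⟩
    suc k * b              ≡⟨ C-ratio k (suc k) ⟩
    a + suc k * a          ∎)
  f*[k+2]≡b : f * suc (suc k) ≡ b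
  f*[k+2]≡b = begin
    f * suc (suc k)  ≡⟨ *-comm f (suc (suc k)) ⟩
    f + suc k * f    ≡⟨ cong (f +_) [k+1]f≡a ⟩
    f + a            ≡⟨ f+a≡b ⟩
    b                ∎

classes-from-representatives : ∀ {γ n N} (Rep : Tree → Set) →
  (∀ {t} → Rep t → arity t ≡ n) →
  (∀ {t u} → Rep t → Rep u → CombCong γ t u → t ≡ u) →
  (∀ t → arity t ≡ n → Σ Tree λ u → Rep u × CombCong γ t u) →
  Enumeration Rep N → CAsCard γ n N
classes-from-representatives {γ} Rep rep-arity rep-distinct rep-cover E =
  (λ i → elem i , rep-arity (valid i)) ,
  (λ i j c → injective (rep-distinct (valid i) (valid j) c)) ,
  λ (t , arity-t) →
    let (u , rep-u , t∼u) = rep-cover t arity-t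
        (i , ei) = surjective u rep-u
    in i , subst (CombCong γ t) (≡.sym ei) t∼u
  where open Enumeration E

classes-below-top : ∀ {γ n N} → n ≢ suc γ → n ≤ suc γ →
  Enumeration (λ t → arity t ≡ n) N → CAsCard γ n N
classes-below-top {γ} {n} n≢ n≤ =
  classes-from-representatives _ (λ eq → eq) distinct (λ t arity-t → t , arity-t , refl)
  where
  distinct : ∀ {t u} → arity t ≡ n → arity u ≡ n → CombCong γ t u → t ≡ u
  distinct arity-t _ c with CombCong-rigid c (arity≤⇒deg≤ (subst (_≤ _) (≡.sym arity-t) n≤))
  ... | inj₁ eq = eq
  ... | inj₂ (ct , _) = ⊥-elim (n≢ (≡.trans (≡.sym arity-t) (IsComb-arity ct)))

classes-at-top : ∀ {γ N} → 2 ≤ γ →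
  Enumeration (λ t → arity t ≡ suc γ) N → CAsCard γ (suc γ) (N ∸ 1)
classes-at-top {γ} 2≤γ E =
  classes-from-representatives Rep proj₁ distinct cover (enum-remove E (IsComb-arity (inj₂ refl)))
  where
  Rep : Tree → Set
  Rep t = arity t ≡ suc γ × t ≢ rcomb γ
  comb≢rcomb⇒lcomb : ∀ {t} → IsComb γ t → t ≢ rcomb γ → t ≡ lcomb γ
  comb≢rcomb⇒lcomb (inj₁ eq) _ = eq
  comb≢rcomb⇒lcomb (inj₂ eq) t≢r = ⊥-elim (t≢r eq)
  distinct : ∀ {t u} → Rep t → Rep u → CombCong γ t u → t ≡ u
  distinct (arity-t , t≢r) (_ , u≢r) c with CombCong-rigid c (≤-reflexive (arity≡suc⇒deg≡ arity-t))
  ... | inj₁ eq = eq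
  ... | inj₂ (ct , cu) = ≡.trans (comb≢rcomb⇒lcomb ct t≢r) (≡.sym (comb≢rcomb⇒lcomb cu u≢r))
  cover : ∀ t → arity t ≡ suc γ → Σ Tree λ u → Rep u × CombCong γ t u
  cover t arity-t with t ≟ᵗ rcomb γ
  ... | yes refl = lcomb γ , (IsComb-arity (inj₁ refl) , lcomb≢rcomb 2≤γ) , sym gen
  ... | no t≢r = t , (arity-t , t≢r) , refl

δ-diag : ∀ n → δ n n ≡ 1
δ-diag zero = refl
δ-diag (suc n) = δ-diag n

δ-offdiag : ∀ {m n} → m ≢ n → δ m n ≡ 0
δ-offdiag {m} {n} m≢n with m ≡ᵇ n in eq
... | false = refl
... | true = ⊥-elim (m≢n (≡ᵇ⇒≡ m n (subst T (≡.sym eq) _)))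

lemma3p2p1 : (γ n : ℕ) → 2 ≤ γ → 1 ≤ n → n ≤ γ + 1 →
    CAsCard γ n (cat (n ∸ 1) ∸ δ n (γ + 1))
lemma3p2p1 γ (suc k) 2≤γ _ n≤γ+1 with k ≟ γ
... | yes refl rewrite +-comm k 1 | δ-diag (suc k) | cat≡forestCount k =
  classes-at-top 2≤γ (trees-enumeration k)
... | no k≢γ rewrite δ-offdiag (k≢γ ∘ suc-injective ∘ λ eq → ≡.trans eq (+-comm γ 1))
                   | cat≡forestCount k =
  classes-below-top (k≢γ ∘ suc-injective) (subst (suc k ≤_) (+-comm γ 1) n≤γ+1)
    (trees-enumeration k)
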